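{- Let $(u_n)_{n\ge 0}$ be the integer sequence defined by $u_0 = 0$, $u_1 = 1$ and $u_n = u_{n-1} - 5u_{n-2}$ for $n \ge 2$. Then $u_n = 1$ if and only if $n \in \{1, 2, 7\}$. -}

module Defs where

open import Data.Nat using (ℕ; zero; suc)
open import Data.Integer using (ℤ; _-_; _*_; +_)

u : ℕ → ℤ
u zero = + 0
u (suc zero) = + 1
u (suc (suc n)) = u (suc n) - (+ 5) * u n

module Submission where

-- Work in ℤ[θ] with θ² = θ − 5, where u n is the θ-coordinate of θⁿ.  Since θ⁸ ≡ 1
-- (mod 3), u is 8-periodic mod 3, and among u 0, …, u 7 only u 1 = u 2 = u 7 = 1 are
-- ≡ 1 (mod 3).  For m ≥ 1, θ⁸ᵐ = 1 + 3P·w with P ≠ 0 and w ≡ c (mod 3), 3 ∤ c: for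
-- 3 ∤ m this is the binomial expansion of (1 + 3γ)ᵐ, and cubing preserves the shape,
-- which covers 3 ∣ m.  Hence u (r + 8m) − u r = 3P·(c·u r + 3Z) ≠ 0 whenever 3 ∤ u r.

open import Defs
open import Data.Nat using (ℕ)
open import Data.Integer using (+_)
open import Data.Sum using (_⊎_)
open import Function.Bundles using (_⇔_)
open import Relation.Binary.PropositionalEquality using (_≡_)

open import Data.Empty using (⊥-elim)
open import Data.Fin.Patterns using (0F; 1F; 2F; 3F; 4F; 5F; 6F; 7F)
open import Data.Integer using (ℤ; 0ℤ; _+_; _-_; _*_; -_; ∣_∣)
open import Data.Integer.Divisibility.Signed
  using (_∣_; divides; _∣?_; ∣ᵤ⇒∣; ∣⇒∣ᵤ; ∣-refl; ∣m+n∣n⇒∣m; ∣m⇒∣m*n)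
open import Data.Integer.Properties using (abs-*; *-identityˡ; i*j≡0⇒i≡0∨j≡0; +-0-abelianGroup)
open import Algebra.Properties.AbelianGroup +-0-abelianGroup using (identityʳ-unique)
open import Data.Integer.Tactic.RingSolver using (solve)
open import Data.List using (_∷_; [])
import Data.Nat as ℕ
open import Data.Nat using (zero; suc)
import Data.Nat.Divisibility as ℕ
import Data.Nat.Properties as ℕ
open import Data.Nat.DivMod using (_divMod_; result)
open import Data.Nat.Induction using (<-rec)
open import Data.Nat.Primality using (Prime; prime?; euclidsLemma)
open import Data.Product using (∃-syntax; _×_; _,_)
open import Data.Sum using (inj₁; inj₂; [_,_]′; map)
open import Function.Base using (_∘_)
open import Function.Bundles using (mk⇔)
open import Relation.Nullary using (¬_)
open import Relation.Nullary.Decidable using (yes; no; from-yes; from-no)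
open import Relation.Binary.PropositionalEquality
  using (_≢_; refl; sym; trans; cong; cong₂; subst; module ≡-Reasoning)

-- ⟨ a , b ⟩ is a + bθ in ℤ[θ], θ² = θ − 5.  A data type rather than a record,
-- so that componentwise goals reduce to polynomials the ring solver can read.
data ℤ[θ] : Set where
  ⟨_,_⟩ : ℤ → ℤ → ℤ[θ]

coeffθ : ℤ[θ] → ℤ
coeffθ ⟨ _ , b ⟩ = b

𝟙 θ : ℤ[θ]
𝟙 = ⟨ + 1 , + 0 ⟩
θ = ⟨ + 0 , + 1 ⟩

infixl 6 _⊕_
infixr 7 _·_
infixl 8 _⊗_
infixr 9 _^_

_⊕_ : ℤ[θ] → ℤ[θ] → ℤ[θ]
⟨ a , b ⟩ ⊕ ⟨ c , d ⟩ = ⟨ a + c , b + d ⟩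

_·_ : ℤ → ℤ[θ] → ℤ[θ]
k · ⟨ a , b ⟩ = ⟨ k * a , k * b ⟩

_⊗_ : ℤ[θ] → ℤ[θ] → ℤ[θ]
⟨ a , b ⟩ ⊗ ⟨ c , d ⟩ = ⟨ a * c - + 5 * (b * d) , a * d + b * c + b * d ⟩

_^_ : ℤ[θ] → ℕ → ℤ[θ]
x ^ zero  = 𝟙
x ^ suc n = x ⊗ x ^ n

⊗-assoc : ∀ x y z → (x ⊗ y) ⊗ z ≡ x ⊗ (y ⊗ z)
⊗-assoc ⟨ a , b ⟩ ⟨ c , d ⟩ ⟨ e , f ⟩ = cong₂ ⟨_,_⟩ (solve vs) (solve vs)
  where vs = a ∷ b ∷ c ∷ d ∷ e ∷ f ∷ []

⊗-identityˡ : ∀ x → 𝟙 ⊗ x ≡ x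
⊗-identityˡ ⟨ a , b ⟩ = cong₂ ⟨_,_⟩ (solve (a ∷ b ∷ [])) (solve (a ∷ b ∷ []))

⊗-distribˡ-⊕· : ∀ x y q z → x ⊗ (y ⊕ q · z) ≡ x ⊗ y ⊕ q · (x ⊗ z)
⊗-distribˡ-⊕· ⟨ a , b ⟩ ⟨ c , d ⟩ q ⟨ e , f ⟩ = cong₂ ⟨_,_⟩ (solve vs) (solve vs)
  where vs = a ∷ b ∷ c ∷ d ∷ q ∷ e ∷ f ∷ []

⊗-·𝟙 : ∀ x c → x ⊗ (c · 𝟙) ≡ c · x
⊗-·𝟙 ⟨ a , b ⟩ c = cong₂ ⟨_,_⟩ (solve (a ∷ b ∷ c ∷ [])) (solve (a ∷ b ∷ c ∷ []))

coeffθ-·⊕· : ∀ c x q y → coeffθ (c · x ⊕ q · y) ≡ c * coeffθ x + q * coeffθ y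
coeffθ-·⊕· c ⟨ a , b ⟩ q ⟨ e , f ⟩ = refl

coeffθ-⊗-·𝟙⊕· : ∀ x c q w → coeffθ (x ⊗ (c · 𝟙 ⊕ q · w)) ≡ c * coeffθ x + q * coeffθ (x ⊗ w)
coeffθ-⊗-·𝟙⊕· x c q w = begin
  coeffθ (x ⊗ (c · 𝟙 ⊕ q · w))    ≡⟨ cong coeffθ (⊗-distribˡ-⊕· x (c · 𝟙) q w) ⟩
  coeffθ (x ⊗ (c · 𝟙) ⊕ q · (x ⊗ w)) ≡⟨ cong (λ y → coeffθ (y ⊕ q · (x ⊗ w))) (⊗-·𝟙 x c) ⟩
  coeffθ (c · x ⊕ q · (x ⊗ w))     ≡⟨ coeffθ-·⊕· c x q (x ⊗ w) ⟩
  c * coeffθ x + q * coeffθ (x ⊗ w) ∎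
  where open ≡-Reasoning

^-distribˡ-+-⊗ : ∀ x m n → x ^ (m ℕ.+ n) ≡ x ^ m ⊗ x ^ n
^-distribˡ-+-⊗ x zero    n = sym (⊗-identityˡ (x ^ n))
^-distribˡ-+-⊗ x (suc m) n =
  trans (cong (x ⊗_) (^-distribˡ-+-⊗ x m n)) (sym (⊗-assoc x (x ^ m) (x ^ n)))

^-*-assoc : ∀ x m n → (x ^ m) ^ n ≡ x ^ (n ℕ.* m)
^-*-assoc x m zero    = refl
^-*-assoc x m (suc n) =
  trans (cong (x ^ m ⊗_) (^-*-assoc x m n)) (sym (^-distribˡ-+-⊗ x m (n ℕ.* m)))

θ^suc : ∀ n → θ ^ suc n ≡ ⟨ - + 5 * u n , u (suc n) ⟩
θ^suc zero    = refl
θ^suc (suc n) = trans (cong (θ ⊗_) (θ^suc n)) (θ⊗ (u n) (u (suc n)))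
  where
  θ⊗ : ∀ a b → θ ⊗ ⟨ - + 5 * a , b ⟩ ≡ ⟨ - + 5 * b , b - + 5 * a ⟩
  θ⊗ a b = cong₂ ⟨_,_⟩ (solve (a ∷ b ∷ [])) (solve (a ∷ b ∷ []))

u≡coeffθ-θ^ : ∀ n → u n ≡ coeffθ (θ ^ n)
u≡coeffθ-θ^ zero    = refl
u≡coeffθ-θ^ (suc n) = cong coeffθ (sym (θ^suc n))

infix 4 _≡_[mod_]
_≡_[mod_] : ℤ[θ] → ℤ[θ] → ℤ → Set
x ≡ y [mod q ] = ∃[ z ] x ≡ y ⊕ q · z

[mod]-trans : ∀ {x y z q} → x ≡ y [mod q ] → y ≡ z [mod q ] → x ≡ z [mod q ]
[mod]-trans {z = ⟨ c , d ⟩} {q} (⟨ e , f ⟩ , refl) (⟨ g , h ⟩ , refl) =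
  ⟨ g , h ⟩ ⊕ ⟨ e , f ⟩ , cong₂ ⟨_,_⟩ (solve vs) (solve vs)
  where vs = c ∷ d ∷ q ∷ e ∷ f ∷ g ∷ h ∷ []

·-congˡ-[mod] : ∀ k {x y q} → x ≡ y [mod q ] → k · x ≡ k · y [mod q ]
·-congˡ-[mod] k {y = ⟨ a , b ⟩} {q} (⟨ e , f ⟩ , refl) =
  k · ⟨ e , f ⟩ , cong₂ ⟨_,_⟩ (solve vs) (solve vs)
  where vs = k ∷ a ∷ b ∷ q ∷ e ∷ f ∷ []

𝟙⊕·-⊗ : ∀ q w w′ → (𝟙 ⊕ q · w) ⊗ (𝟙 ⊕ q · w′) ≡ 𝟙 ⊕ q · (w ⊕ w′ ⊕ q · (w ⊗ w′))
𝟙⊕·-⊗ q ⟨ a , b ⟩ ⟨ c , d ⟩ = cong₂ ⟨_,_⟩ (solve vs) (solve vs)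
  where vs = q ∷ a ∷ b ∷ c ∷ d ∷ []

𝟙⊕·-^ : ∀ q w k → ∃[ w′ ] ((𝟙 ⊕ q · w) ^ k ≡ 𝟙 ⊕ q · w′) × (w′ ≡ + k · w [mod q ])
𝟙⊕·-^ q ⟨ a , b ⟩ zero =
  𝟘 , cong₂ ⟨_,_⟩ (solve vs) (solve vs) , 𝟘 , cong₂ ⟨_,_⟩ (solve vs) (solve vs)
  where
  𝟘 = ⟨ + 0 , + 0 ⟩
  vs = q ∷ a ∷ b ∷ []
𝟙⊕·-^ q w (suc k) with 𝟙⊕·-^ q w k
... | w′ , eq , (z , w′≡) =
  w ⊕ w′ ⊕ q · (w ⊗ w′) ,
  trans (cong ((𝟙 ⊕ q · w) ⊗_) eq) (𝟙⊕·-⊗ q w w′) ,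
  z ⊕ w ⊗ w′ , trans (cong (λ v → w ⊕ v ⊕ q · (w ⊗ w′)) w′≡) (regroup (+ k) w z (w ⊗ w′))
  where
  regroup : ∀ K w z y → w ⊕ (K · w ⊕ q · z) ⊕ q · y ≡ (+ 1 + K) · w ⊕ q · (z ⊕ y)
  regroup K ⟨ a , b ⟩ ⟨ e , f ⟩ ⟨ g , h ⟩ = cong₂ ⟨_,_⟩ (solve vs) (solve vs)
    where vs = q ∷ K ∷ a ∷ b ∷ e ∷ f ∷ g ∷ h ∷ []

𝟙⊕3P·-^3 : ∀ P w →
  (𝟙 ⊕ (+ 3 * P) · w) ^ 3 ≡ 𝟙 ⊕ (+ 3 * (+ 3 * P)) · (w ⊕ + 3 · P · (w ⊗ w ⊕ P · w ⊗ w ⊗ w))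
𝟙⊕3P·-^3 P ⟨ a , b ⟩ = cong₂ ⟨_,_⟩ (solve (P ∷ a ∷ b ∷ [])) (solve (P ∷ a ∷ b ∷ []))

record NearOne (x : ℤ[θ]) : Set where
  constructor nearOne
  field
    P   : ℤ
    P≢0 : P ≢ 0ℤ
    c   : ℤ
    3∤c : ¬ + 3 ∣ c
    w   : ℤ[θ]
    w≡c : w ≡ c · 𝟙 [mod + 3 ]
    x≡  : x ≡ 𝟙 ⊕ (+ 3 * P) · w

*-≢0 : ∀ {i j} → i ≢ 0ℤ → j ≢ 0ℤ → i * j ≢ 0ℤ
*-≢0 i≢0 j≢0 ij≡0 = [ i≢0 , j≢0 ]′ (i*j≡0⇒i≡0∨j≡0 _ ij≡0)

NearOne-^3 : ∀ {x} → NearOne x → NearOne (x ^ 3)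
NearOne-^3 (nearOne P P≢0 c 3∤c w w≡c refl) =
  nearOne (+ 3 * P) (*-≢0 {+ 3} (λ ()) P≢0) c 3∤c _ ([mod]-trans (_ , refl) w≡c) (𝟙⊕3P·-^3 P w)

-- θ⁸ = −5 − 279θ = 𝟙 ⊕ 3γ
γ : ℤ[θ]
γ = ⟨ - + 2 , - + 93 ⟩

γ≡𝟙 : γ ≡ 𝟙 [mod + 3 ]
γ≡𝟙 = ⟨ - + 1 , - + 31 ⟩ , refl

θ⁸^-nearOne-coprime : ∀ k → ¬ 3 ℕ.∣ k → NearOne ((θ ^ 8) ^ k)
θ⁸^-nearOne-coprime k 3∤k with 𝟙⊕·-^ (+ 3) γ k
... | w , θ⁸^k≡ , w≡kγ =
  nearOne (+ 1) (λ ()) (+ k) (3∤k ∘ ∣⇒∣ᵤ) w ([mod]-trans w≡kγ (·-congˡ-[mod] (+ k) γ≡𝟙)) θ⁸^k≡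

θ⁸^-nearOne : ∀ m → NearOne ((θ ^ 8) ^ suc m)
θ⁸^-nearOne = <-rec (λ m → NearOne ((θ ^ 8) ^ suc m)) step
  where
  step : ∀ m → (∀ {j} → j ℕ.< m → NearOne ((θ ^ 8) ^ suc j)) → NearOne ((θ ^ 8) ^ suc m)
  step m rec with 3 ℕ.∣? suc m
  ... | no 3∤ = θ⁸^-nearOne-coprime (suc m) 3∤
  ... | yes (ℕ.divides (suc q) eq) = subst NearOne cube≡ (NearOne-^3 (rec q<m))
    where
    q<m : q ℕ.< m
    q<m = ℕ.s<s⁻¹ (subst (suc q ℕ.<_) (sym eq) (ℕ.m<m*n (suc q) 3 (ℕ.s≤s (ℕ.s≤s ℕ.z≤n))))
    cube≡ : ((θ ^ 8) ^ suc q) ^ 3 ≡ (θ ^ 8) ^ suc m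
    cube≡ = trans (^-*-assoc (θ ^ 8) (suc q) 3)
                  (cong ((θ ^ 8) ^_) (trans (ℕ.*-comm 3 (suc q)) (sym eq)))

u-shift : ∀ r m q w → (θ ^ 8) ^ m ≡ 𝟙 ⊕ q · w → u (r ℕ.+ m ℕ.* 8) ≡ u r + q * coeffθ (θ ^ r ⊗ w)
u-shift r m q w θ⁸^m≡ = begin
  u (r ℕ.+ m ℕ.* 8)                               ≡⟨ u≡coeffθ-θ^ (r ℕ.+ m ℕ.* 8) ⟩
  coeffθ (θ ^ (r ℕ.+ m ℕ.* 8))                    ≡⟨ cong coeffθ (^-distribˡ-+-⊗ θ r (m ℕ.* 8)) ⟩
  coeffθ (θ ^ r ⊗ θ ^ (m ℕ.* 8))                  ≡⟨ cong (λ y → coeffθ (θ ^ r ⊗ y)) θ^m8≡ ⟩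
  coeffθ (θ ^ r ⊗ (𝟙 ⊕ q · w))                    ≡⟨ coeffθ-⊗-·𝟙⊕· (θ ^ r) (+ 1) q w ⟩
  + 1 * coeffθ (θ ^ r) + q * coeffθ (θ ^ r ⊗ w)   ≡⟨ cong (_+ q * coeffθ (θ ^ r ⊗ w)) 1*u ⟩
  u r + q * coeffθ (θ ^ r ⊗ w)                    ∎
  where
  open ≡-Reasoning
  θ^m8≡ = trans (sym (^-*-assoc θ 8 m)) θ⁸^m≡
  1*u = trans (*-identityˡ _) (sym (u≡coeffθ-θ^ r))

a≡b+q*x⇒q∣a-b : ∀ {a} b q x → a ≡ b + q * x → q ∣ a - b
a≡b+q*x⇒q∣a-b b q x refl = divides x (solve (b ∷ q ∷ x ∷ []))

u-periodic-mod3 : ∀ r m → + 3 ∣ u (r ℕ.+ m ℕ.* 8) - u r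
u-periodic-mod3 r m with 𝟙⊕·-^ (+ 3) γ m
... | w , θ⁸^m≡ , _ = a≡b+q*x⇒q∣a-b (u r) (+ 3) _ (u-shift r m (+ 3) w θ⁸^m≡)

u≢1-mod-3 : ∀ r m → ¬ + 3 ∣ + 1 - u r → u (r ℕ.+ m ℕ.* 8) ≢ + 1
u≢1-mod-3 r m 3∤1-ur u≡1 = 3∤1-ur (subst (λ t → + 3 ∣ t - u r) u≡1 (u-periodic-mod3 r m))

euclidsLemma-ℤ : ∀ {p} i j → Prime p → + p ∣ i * j → (+ p ∣ i) ⊎ (+ p ∣ j)
euclidsLemma-ℤ i j pp p∣ij =
  map ∣ᵤ⇒∣ ∣ᵤ⇒∣ (euclidsLemma ∣ i ∣ ∣ j ∣ pp (subst (_ ℕ.∣_) (abs-* i j) (∣⇒∣ᵤ p∣ij)))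

u-shift-≢ : ∀ r m → ¬ + 3 ∣ u r → u (r ℕ.+ suc m ℕ.* 8) ≢ u r
u-shift-≢ r m 3∤ur u≡ with θ⁸^-nearOne m
... | nearOne P P≢0 c 3∤c _ (z , refl) θ⁸^≡ =
  [ 3∤c , 3∤ur ]′ (euclidsLemma-ℤ c (u r) (from-yes (prime? 3)) 3∣c*ur)
  where
  X = coeffθ (θ ^ r ⊗ (c · 𝟙 ⊕ + 3 · z))
  3P*X≡0 : (+ 3 * P) * X ≡ 0ℤ
  3P*X≡0 = identityʳ-unique (u r) _ (trans (sym (u-shift r (suc m) _ _ θ⁸^≡)) u≡)
  X≡0 : X ≡ 0ℤ
  X≡0 with i*j≡0⇒i≡0∨j≡0 (+ 3 * P) 3P*X≡0
  ... | inj₁ 3P≡0 = ⊥-elim (*-≢0 {+ 3} (λ ()) P≢0 3P≡0)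
  ... | inj₂ X≡0  = X≡0
  X≡ : X ≡ c * u r + + 3 * coeffθ (θ ^ r ⊗ z)
  X≡ = trans (coeffθ-⊗-·𝟙⊕· (θ ^ r) c (+ 3) z)
             (cong (λ t → c * t + + 3 * coeffθ (θ ^ r ⊗ z)) (sym (u≡coeffθ-θ^ r)))
  3∣c*ur : + 3 ∣ c * u r
  3∣c*ur = ∣m+n∣n⇒∣m (subst (+ 3 ∣_) (trans (sym X≡0) X≡) (divides 0ℤ refl)) (∣m⇒∣m*n _ ∣-refl)

u≡1⇒ : ∀ n → u n ≡ + 1 → n ≡ 1 ⊎ n ≡ 2 ⊎ n ≡ 7
u≡1⇒ n u≡1 with n divMod 8
... | result m 0F refl = ⊥-elim (u≢1-mod-3 0 m (from-no (+ 3 ∣? + 1 - u 0)) u≡1)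
... | result m 3F refl = ⊥-elim (u≢1-mod-3 3 m (from-no (+ 3 ∣? + 1 - u 3)) u≡1)
... | result m 4F refl = ⊥-elim (u≢1-mod-3 4 m (from-no (+ 3 ∣? + 1 - u 4)) u≡1)
... | result m 5F refl = ⊥-elim (u≢1-mod-3 5 m (from-no (+ 3 ∣? + 1 - u 5)) u≡1)
... | result m 6F refl = ⊥-elim (u≢1-mod-3 6 m (from-no (+ 3 ∣? + 1 - u 6)) u≡1)
... | result zero 1F refl = inj₁ refl
... | result zero 2F refl = inj₂ (inj₁ refl)
... | result zero 7F refl = inj₂ (inj₂ refl)
... | result (suc m) 1F refl = ⊥-elim (u-shift-≢ 1 m (from-no (+ 3 ∣? + 1)) u≡1)
... | result (suc m) 2F refl = ⊥-elim (u-shift-≢ 2 m (from-no (+ 3 ∣? + 1)) u≡1)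
... | result (suc m) 7F refl = ⊥-elim (u-shift-≢ 7 m (from-no (+ 3 ∣? + 1)) u≡1)

lemma5p2 : (n : ℕ) → (u n ≡ + 1) ⇔ (n ≡ 1 ⊎ n ≡ 2 ⊎ n ≡ 7)
lemma5p2 n = mk⇔ (u≡1⇒ n) ⇒u≡1
  where
  ⇒u≡1 : n ≡ 1 ⊎ n ≡ 2 ⊎ n ≡ 7 → u n ≡ + 1
  ⇒u≡1 (inj₁ refl)        = refl
  ⇒u≡1 (inj₂ (inj₁ refl)) = refl
  ⇒u≡1 (inj₂ (inj₂ refl)) = refl
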